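{- Let $G$ be a connected finite graph, $k$ a positive integer, and $T'=(\mathcal{P},F)$ a monotone search strategy for $k$ searchers in $G$. Let $T$ be the undirected tree obtained from $T'$ by ignoring edge orientations. Then $(T,(X)_{(X,R)\in\mathcal{P}})$, i.e. $T$ with bag $X$ at node $(X,R)$, is a tree decomposition of $G$ of width at most $k-1$.
   Context: For $X\subseteq V(G)$, an $X$-flap is the vertex set of a connected component of $G-X$. A position is a pair $(X,R)$ with $X\subseteq V(G)$ and $R$ a union of (zero or more) $X$-flaps. A monotone search strategy (MSS) with $k$ searchers is a directed tree $T'=(\mathcal{P},F)$ whose nodes are positions with $|X|\leq k$, such that (i) the root is $(\emptyset,V(G))$; (ii) every leaf $(X,R)$ has $R=\emptyset$ (the root is not considered a leaf); (iii) for every non-leaf $(X,R)$ we have $R\neq\emptyset$ and there is $X'\subseteq X\cup R$ with exactly one of: (a) $X'\subsetneq X$ and $(X',R)$ is the unique out-neighbour; (b) $X'\supsetneq X$ and $(X',R\setminus X')$ is the unique out-neighbour; (c) $X'=X$ and the out-neighbours are $(X,R_1),\dots,(X,R_t)$, $t\geq 2$, where $R_1,\dots,R_t$ are the $X$-flaps contained in $R$. A tree decomposition of $G$ is a tree with a bag $X_i\subseteq V(G)$ at each node $i$ such that the bags cover $V(G)$, each edge has both ends in some bag, and for each vertex $v$ the nodes whose bags contain $v$ form a connected subtree; its width is the maximum bag size minus one. -}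

module Defs where

open import Data.Nat using (ℕ; _≤_; _∸_)
open import Data.Bool using (Bool; true)
open import Data.Fin using (Fin)
open import Data.Fin.Subset using (Subset; _∈_; _∉_; _⊆_; _⊂_; _∪_; _─_; ⊥; ⊤; Nonempty; ∣_∣)
open import Data.List using (List; []; _∷_; _++_; [_]; length)
open import Data.List.Relation.Unary.Unique.Propositional using (Unique)
open import Data.Product using (Σ; ∃; ∃-syntax; _×_; _,_)
open import Data.Sum using (_⊎_)
open import Data.Unit using () renaming (⊤ to Unit)
open import Data.Empty using () renaming (⊥ to Empty)
open import Relation.Nullary using (¬_)
open import Relation.Binary.PropositionalEquality using (_≡_; _≢_)

record Graph (n : ℕ) : Set where
  field
    adj : Fin n → Fin n → Bool
    adj-sym : ∀ u v → adj u v ≡ adj v u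

Edge : ∀ {n} → Graph n → Fin n → Fin n → Set
Edge G u v = Graph.adj G u v ≡ true

data Walk {A : Set} (R : A → A → Set) (P : A → Set) : A → A → Set where
  stop : ∀ {x} → P x → Walk R P x x
  step : ∀ {x y z} → P x → R x y → Walk R P y z → Walk R P x z

Connected : ∀ {n} → Graph n → Set
Connected G = ∀ u v → Walk (Edge G) (λ _ → Unit) u v

-- X-flaps: vertex sets of connected components of G - X

IsFlap : ∀ {n} → Graph n → Subset n → Subset n → Set
IsFlap G X C =
  Nonempty C
  × (∀ v → v ∈ C → v ∉ X)
  × (∀ u v → u ∈ C → v ∈ C → Walk (Edge G) (λ w → w ∉ X) u v)
  × (∀ u v → u ∈ C → v ∉ X → Edge G u v → v ∈ C)

IsUnionOfFlaps : ∀ {n} → Graph n → Subset n → Subset n → Set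
IsUnionOfFlaps G X R = ∀ v → v ∈ R → ∃[ C ] (IsFlap G X C × C ⊆ R × v ∈ C)

record IsDirectedTree {m : ℕ} (F : Fin m → Fin m → Set) (r : Fin m) : Set where
  field
    root-no-in : ∀ a → ¬ F a r
    unique-in  : ∀ b → b ≢ r → ∃[ a ] (F a b × (∀ a' → F a' b → a' ≡ a))
    reachable  : ∀ b → Walk F (λ _ → Unit) r b

Position : ℕ → Set
Position n = Subset n × Subset n

record MSS {n : ℕ} (G : Graph n) (k : ℕ) : Set₁ where
  field
    m    : ℕ
    F    : Fin m → Fin m → Set
    root : Fin m
    dtree : IsDirectedTree F root
    -- node a is the position (X a , R a); distinct nodes are distinct positions
    X : Fin m → Subset n
    R : Fin m → Subset n
    pos-inj : ∀ a b → (X a , R a) ≡ (X b , R b) → a ≡ b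
    position : ∀ a → IsUnionOfFlaps G (X a) (R a)
    searchers : ∀ a → ∣ X a ∣ ≤ k
    root-pos : X root ≡ ⊥ × R root ≡ ⊤
  UniqueOut : Fin m → Position n → Set
  UniqueOut a p = ∃[ b ] (F a b × (X b , R b) ≡ p × (∀ b' → F a b' → b' ≡ b))
  Move : Fin m → Set
  Move a = ∃[ X' ] (X' ⊆ X a ∪ R a ×
      ( (X' ⊂ X a × UniqueOut a (X' , R a))
      ⊎ (X a ⊂ X' × UniqueOut a (X' , R a ─ X'))
      ⊎ (X' ≡ X a
         × (∀ b → F a b → X b ≡ X a × IsFlap G (X a) (R b) × R b ⊆ R a)
         × (∀ C → IsFlap G (X a) C → C ⊆ R a → ∃[ b ] (F a b × R b ≡ C))
         × ∃[ C₁ ] ∃[ C₂ ] (IsFlap G (X a) C₁ × C₁ ⊆ R a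
                            × IsFlap G (X a) C₂ × C₂ ⊆ R a × C₁ ≢ C₂))))
  field
    leaf : ∀ a → a ≢ root → (∀ b → ¬ F a b) → R a ≡ ⊥
    nonleaf : ∀ a → (a ≡ root ⊎ ∃[ b ] F a b) → Nonempty (R a) × Move a

Undirected : ∀ {m} → (Fin m → Fin m → Set) → Fin m → Fin m → Set
Undirected F a b = F a b ⊎ F b a

Chain : ∀ {m} → (Fin m → Fin m → Set) → List (Fin m) → Set
Chain E []           = Unit
Chain E (x ∷ [])     = Unit
Chain E (x ∷ y ∷ xs) = E x y × Chain E (y ∷ xs)

IsCycle : ∀ {m} → (Fin m → Fin m → Set) → List (Fin m) → Set
IsCycle E []       = Empty
IsCycle E (x ∷ xs) = 3 ≤ length (x ∷ xs) × Unique (x ∷ xs) × Chain E (x ∷ xs ++ [ x ])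

record IsTree {m : ℕ} (E : Fin m → Fin m → Set) : Set where
  field
    symmetric   : ∀ a b → E a b → E b a
    irreflexive : ∀ a → ¬ E a a
    connected   : ∀ a b → Walk E (λ _ → Unit) a b
    acyclic     : ∀ cs → ¬ IsCycle E cs

record IsTreeDecomposition {n m : ℕ} (G : Graph n) (E : Fin m → Fin m → Set)
                           (bag : Fin m → Subset n) : Set where
  field
    tree  : IsTree E
    cover : ∀ v → ∃[ i ] (v ∈ bag i)
    edges : ∀ u v → Edge G u v → ∃[ i ] (u ∈ bag i × v ∈ bag i)
    subtree : ∀ v i j → v ∈ bag i → v ∈ bag j → Walk E (λ l → v ∈ bag l) i j

WidthAtMost : ∀ {n m} → (Fin m → Subset n) → ℕ → Set
WidthAtMost bag w = ∀ i → ∣ bag i ∣ ∸ 1 ≤ w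

-- The potential |R| + |X ∪ R| strictly decreases along every move.  Since every node of the
-- strategy has at most one parent, this makes its underlying graph acyclic and every descent
-- from the root finite.  A vertex, or both ends of an edge, stays in X ∪ R as long as one of
-- them is contaminated, and contamination must end, so they are guarded together at some node.
-- Finally the nodes with v ∈ X ∪ R form a rooted subtree that cannot branch while v ∈ R,
-- because v lies in a single flap; hence the nodes guarding v are connected.
module Submission where

open import Defs
open import Data.Nat using (ℕ; _≤_; _∸_)
open import Data.Product using (_×_)

open import Data.Nat using (suc; _+_; _<_; s≤s)
open import Data.Nat.Induction using (<-wellFounded)
open import Data.Nat.Properties
  using (+-comm; +-mono-≤-<; +-mono-<-≤; <-irrefl; <⇒≱; ∸-monoˡ-≤)
open import Data.Fin using (Fin)
open import Data.Fin.Properties using (any?) renaming (_≟_ to _≟ᶠ_)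
open import Data.Fin.Subset using (Subset; _∈_; _∉_; _⊆_; _∪_; Nonempty; ∣_∣)
open import Data.Fin.Subset.Properties
  using ( _∈?_; ∉⊥; ∈⊤; ⊆-antisym; ⊆-reflexive; x∈p∪q⁻; x∈p∪q⁺; p─q⊆p
        ; x∈p∧x∉q⇒x∈p─q; p∩q≢∅⇒∣p─q∣<∣p∣; x∈p∩q⁺; p⊆q⇒∣p∣≤∣q∣; p⊂q⇒∣p∣<∣q∣ )
open import Data.Product using (∃-syntax; _,_; proj₁; proj₂)
open import Data.Sum using (_⊎_; inj₁; inj₂; [_,_]′) renaming (swap to ⊎-swap)
open import Data.Unit using (tt)
open import Data.Empty using () renaming (⊥-elim to contradiction)
open import Data.List using (List; []; _∷_; _++_; [_]; length)
open import Data.List.Properties using (length-++; ++-assoc; ++-identityʳ)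
open import Data.List.Relation.Unary.All using (All; []; _∷_; lookup)
open import Data.List.Relation.Unary.All.Properties using (++⁺; ++⁻)
open import Data.List.Relation.Unary.Any using (here; there)
open import Data.List.Membership.Propositional using () renaming (_∈_ to _∈ˡ_)
open import Data.List.Membership.Propositional.Properties using (∈-∃++)
open import Data.List.Extrema.Nat using (argmin; argmin-sel; f[argmin]≤f[⊤]; f[argmin]≤f[xs])
open import Data.List.Relation.Unary.Unique.Propositional using (Unique)
open import Data.List.Relation.Unary.AllPairs using ([]; _∷_) renaming (tail to unique-tail)
open import Data.List.Relation.Unary.Unique.Propositional.Properties
  using (Unique[x∷xs]⇒x∉xs) renaming (++⁺ to unique-++⁺)
open import Function using (_∘_; _on_)
open import Induction.WellFounded using (Acc; acc)
open import Relation.Binary.Construct.On using () renaming (wellFounded to on-wellFounded)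
open import Relation.Nullary using (¬_; Dec; yes; no)
open import Relation.Nullary.Decidable using (decidable-stable; _×-dec_)
open import Relation.Binary.PropositionalEquality
  using (_≡_; _≢_; refl; sym; trans; cong; cong₂; subst)

walk-head : ∀ {A : Set} {E : A → A → Set} {P : A → Set} {x y} → Walk E P x y → P x
walk-head (stop p)     = p
walk-head (step p _ _) = p

_++ʷ_ : ∀ {A : Set} {E : A → A → Set} {P : A → Set} {x y z} →
        Walk E P x y → Walk E P y z → Walk E P x z
stop _     ++ʷ q = q
step p e w ++ʷ q = step p e (w ++ʷ q)

lift-backward-closed : ∀ {A : Set} {E : A → A → Set} {P Q : A → Set} →
  (∀ {x y} → E x y → P y → P x) → ∀ {x y} → Walk E Q x y → P y → Walk E P x y
lift-backward-closed closed (stop _)     py = stop py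
lift-backward-closed closed (step _ e w) py =
  step (closed e (walk-head w′)) e w′
  where w′ = lift-backward-closed closed w py

lift-forward-closed : ∀ {A : Set} {E : A → A → Set} {P Q : A → Set} →
  (∀ {x y} → E x y → P x → Q y → P y) → ∀ {x y} → P x → Walk E Q x y → Walk E P x y
lift-forward-closed closed px (stop _)     = stop px
lift-forward-closed closed px (step _ e w) =
  step px e (lift-forward-closed closed (closed e px (walk-head w)) w)

module _ {m : ℕ} {F : Fin m → Fin m → Set} {P : Fin m → Set} where

  undirected : ∀ {x y} → Walk F P x y → Walk (Undirected F) P x y
  undirected (stop p)     = stop p
  undirected (step p f w) = step p (inj₁ f) (undirected w)

  reverseᵘ : ∀ {x y} → Walk (Undirected F) P x y → Walk (Undirected F) P y x
  reverseᵘ (stop p)     = stop p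
  reverseᵘ (step p e w) = reverseᵘ w ++ʷ step (walk-head w) (⊎-swap e) (stop p)

module Flaps {n : ℕ} (G : Graph n) (X : Subset n) where

  flap-closed : ∀ {C u w} → IsFlap G X C → u ∈ C → Walk (Edge G) (_∉ X) u w → w ∈ C
  flap-closed fl u∈C (stop _)     = u∈C
  flap-closed fl u∈C (step _ e w) = flap-closed fl (proj₂ (proj₂ (proj₂ fl)) _ _ u∈C (walk-head w) e) w

  flap-⊆ : ∀ {C D w} → IsFlap G X C → IsFlap G X D → w ∈ C → w ∈ D → C ⊆ D
  flap-⊆ flC flD w∈C w∈D x∈C = flap-closed flD w∈D (proj₁ (proj₂ (proj₂ flC)) _ _ w∈C x∈C)

  flap-unique : ∀ {C D w} → IsFlap G X C → IsFlap G X D → w ∈ C → w ∈ D → C ≡ D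
  flap-unique flC flD w∈C w∈D = ⊆-antisym (flap-⊆ flC flD w∈C w∈D) (flap-⊆ flD flC w∈D w∈C)

  two-flaps⇒⊈-flap : ∀ {A B C₁ C₂} → IsFlap G X B →
    IsFlap G X C₁ → C₁ ⊆ A → IsFlap G X C₂ → C₂ ⊆ A → C₁ ≢ C₂ → ∃[ x ] (x ∈ A × x ∉ B)
  two-flaps⇒⊈-flap {B = B} flB fl₁ C₁⊆A fl₂ C₂⊆A C₁≢C₂
    with proj₁ fl₁ | proj₁ fl₂
  ... | w₁ , w₁∈C₁ | w₂ , w₂∈C₂ with w₁ ∈? B | w₂ ∈? B
  ... | no w₁∉B  | _        = w₁ , C₁⊆A w₁∈C₁ , w₁∉B
  ... | yes _    | no w₂∉B  = w₂ , C₂⊆A w₂∈C₂ , w₂∉B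
  ... | yes w₁∈B | yes w₂∈B =
    contradiction (C₁≢C₂ (trans (flap-unique fl₁ flB w₁∈C₁ w₁∈B) (flap-unique flB fl₂ w₂∈B w₂∈C₂)))

module Forest {m : ℕ} {F : Fin m → Fin m → Set} (φ : Fin m → ℕ)
    (φ-decreasing : ∀ {a b} → F a b → φ b < φ a)
    (in-unique : ∀ {a a′ b} → F a b → F a′ b → a ≡ a′) where

  private
    E : Fin m → Fin m → Set
    E = Undirected F

  irreflexive : ∀ a → ¬ E a a
  irreflexive a (inj₁ f) = <-irrefl refl (φ-decreasing f)
  irreflexive a (inj₂ f) = <-irrefl refl (φ-decreasing f)

  arc-into-lower : ∀ {a b} → E a b → φ a ≤ φ b → F b a
  arc-into-lower (inj₁ f) φa≤φb = contradiction (<⇒≱ (φ-decreasing f) φa≤φb)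
  arc-into-lower (inj₂ f) _     = f

  last : Fin m → List (Fin m) → Fin m
  last x []       = x
  last x (y ∷ ys) = last y ys

  last-∈ : ∀ x xs → last x xs ∈ˡ x ∷ xs
  last-∈ x []       = here refl
  last-∈ x (y ∷ ys) = there (last-∈ y ys)

  last-++ : ∀ x xs y → last x (xs ++ [ y ]) ≡ y
  last-++ x []       y = refl
  last-++ x (z ∷ zs) y = last-++ z zs y

  chain-last : ∀ x xs y → Chain E (x ∷ xs ++ [ y ]) → E (last x xs) y
  chain-last x []       y (e , _) = e
  chain-last x (z ∷ zs) y (_ , c) = chain-last z zs y c

  chain-snoc : ∀ x xs y → Chain E (x ∷ xs) → E (last x xs) y → Chain E (x ∷ xs ++ [ y ])
  chain-snoc x []       y _       e = e , tt
  chain-snoc x (z ∷ zs) y (e′ , c) e = e′ , chain-snoc z zs y c e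

  rotate : ∀ x xs → IsCycle E (x ∷ xs) → IsCycle E (xs ++ [ x ])
  rotate x []       (s≤s () , _)
  rotate x (y ∷ ys) (3≤len , uniq , e , c) =
    subst (λ l → 3 ≤ suc l) (sym (trans (length-++ ys) (+-comm (length ys) 1))) 3≤len ,
    unique-++⁺ (unique-tail uniq) ([] ∷ []) (λ { (x∈ , here refl) → Unique[x∷xs]⇒x∉xs uniq x∈ }) ,
    chain-snoc y (ys ++ [ x ]) y c (subst (λ z → E z y) (sym (last-++ y ys x)) e)

  rotate-to : ∀ as x bs → IsCycle E (as ++ x ∷ bs) → IsCycle E (x ∷ bs ++ as)
  rotate-to []       x bs cyc = subst (λ l → IsCycle E (x ∷ l)) (sym (++-identityʳ bs)) cyc
  rotate-to (a ∷ as) x bs cyc =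
    subst (λ l → IsCycle E (x ∷ l)) (++-assoc bs [ a ] as)
      (rotate-to as x (bs ++ [ a ]) (subst (IsCycle E) (++-assoc as (x ∷ bs) [ a ]) (rotate a _ cyc)))

  -- Both cycle-neighbours of a vertex of minimal potential would be its parent.
  no-cycle-from-minimum : ∀ x xs → IsCycle E (x ∷ xs) → ¬ All (λ z → φ x ≤ φ z) xs
  no-cycle-from-minimum x []           (s≤s () , _)
  no-cycle-from-minimum x (y ∷ [])     (s≤s (s≤s ()) , _)
  no-cycle-from-minimum x (y ∷ z ∷ ws) (_ , uniq , e , c) (x≤y ∷ x≤zws) =
    Unique[x∷xs]⇒x∉xs (unique-tail uniq) (subst (_∈ˡ z ∷ ws) (sym y≡w) (last-∈ z ws))
    where
    w = last z ws
    y≡w : y ≡ w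
    y≡w = in-unique (arc-into-lower e x≤y)
                    (arc-into-lower (⊎-swap (chain-last y (z ∷ ws) x c)) (lookup x≤zws (last-∈ z ws)))

  no-cycle-through-minimum : ∀ {x cs} → x ∈ˡ cs → All (λ z → φ x ≤ φ z) cs → ¬ IsCycle E cs
  no-cycle-through-minimum {x} x∈cs x≤cs cyc with ∈-∃++ x∈cs
  ... | as , bs , refl with ++⁻ as x≤cs
  ...   | x≤as , _ ∷ x≤bs = no-cycle-from-minimum x (bs ++ as) (rotate-to as x bs cyc) (++⁺ x≤bs x≤as)

  acyclic : ∀ cs → ¬ IsCycle E cs
  acyclic []       ()
  acyclic (c ∷ cs) =
    no-cycle-through-minimum ([ here , there ]′ (argmin-sel φ c cs))
                             (f[argmin]≤f[⊤] {f = φ} c cs ∷ f[argmin]≤f[xs] c cs)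

module Strategy {n : ℕ} {G : Graph n} {k : ℕ} (S : MSS G k) where
  open MSS S
  open IsDirectedTree dtree

  Uncleared : Fin m → Fin n → Set
  Uncleared a v = v ∈ X a ⊎ v ∈ R a

  unguarded⇒contaminated : ∀ {a v} → v ∉ X a → Uncleared a v → v ∈ R a
  unguarded⇒contaminated v∉X (inj₁ v∈X) = contradiction (v∉X v∈X)
  unguarded⇒contaminated v∉X (inj₂ v∈R) = v∈R

  R-root : ∀ v → v ∈ R root
  R-root v = subst (v ∈_) (sym (proj₂ root-pos)) ∈⊤

  R-disjoint-X : ∀ a {v} → v ∈ R a → v ∉ X a
  R-disjoint-X a v∈R with position a _ v∈R
  ... | C , flap , _ , v∈C = proj₁ (proj₂ flap) _ v∈C

  R-closed : ∀ a {u w} → u ∈ R a → Edge G u w → Uncleared a w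
  R-closed a {w = w} u∈R e with w ∈? X a
  ... | yes w∈X = inj₁ w∈X
  ... | no  w∉X with position a _ u∈R
  ...   | C , flap , C⊆R , u∈C = inj₂ (C⊆R (proj₂ (proj₂ (proj₂ flap)) _ w u∈C w∉X e))

  in-flap-child : ∀ a {v} → v ∈ R a →
    (∀ C → IsFlap G (X a) C → C ⊆ R a → ∃[ b ] (F a b × R b ≡ C)) → ∃[ b ] (F a b × v ∈ R b)
  in-flap-child a v∈R children with position a _ v∈R
  ... | C , flap , C⊆R , v∈C with children C flap C⊆R
  ...   | b , f , R≡C = b , f , subst (_ ∈_) (sym R≡C) v∈C

  in-unique : ∀ {a a′ b} → F a b → F a′ b → a ≡ a′
  in-unique {b = b} f f′ with b ≟ᶠ root
  ... | yes refl = contradiction (root-no-in _ f)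
  ... | no  b≢r with unique-in b b≢r
  ...   | _ , _ , parent = trans (parent _ f) (sym (parent _ f′))

  move-of-arc : ∀ {a b} → F a b → Move a
  move-of-arc {a} f = proj₂ (nonleaf a (inj₂ (_ , f)))

  unique-out-target : ∀ {a p b} → UniqueOut a p → F a b → (X b , R b) ≡ p
  unique-out-target (_ , _ , target , out) f with out _ f
  ... | refl = target

  R-antitone : ∀ {a b} → F a b → R b ⊆ R a
  R-antitone {a} f with move-of-arc f
  ... | X′ , _ , inj₁ (_ , out)        = ⊆-reflexive (cong proj₂ (unique-out-target out f))
  ... | X′ , _ , inj₂ (inj₁ (_ , out)) =
    p─q⊆p (R a) X′ ∘ subst (_ ∈_) (cong proj₂ (unique-out-target out f))
  ... | X′ , _ , inj₂ (inj₂ (_ , children , _)) = proj₂ (proj₂ (children _ f))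

  Uncleared-antitone : ∀ {a b v} → F a b → Uncleared b v → Uncleared a v
  Uncleared-antitone f (inj₂ v∈R) = inj₂ (R-antitone f v∈R)
  Uncleared-antitone {a} {v = v} f (inj₁ v∈X) with move-of-arc f
  ... | X′ , _ , inj₁ (X′⊂X , out) =
    inj₁ (proj₁ X′⊂X (subst (v ∈_) (cong proj₁ (unique-out-target out f)) v∈X))
  ... | X′ , X′⊆ , inj₂ (inj₁ (_ , out)) =
    x∈p∪q⁻ (X a) (R a) (X′⊆ (subst (v ∈_) (cong proj₁ (unique-out-target out f)) v∈X))
  ... | X′ , _ , inj₂ (inj₂ (_ , children , _)) = inj₁ (subst (v ∈_) (proj₁ (children _ f)) v∈X)

  X∪R-antitone : ∀ {a b} → F a b → X b ∪ R b ⊆ X a ∪ R a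
  X∪R-antitone {a} {b} f = x∈p∪q⁺ ∘ Uncleared-antitone f ∘ x∈p∪q⁻ (X b) (R b)

  potential : Fin m → ℕ
  potential a = ∣ R a ∣ + ∣ X a ∪ R a ∣

  potential-decreasing : ∀ {a b} → F a b → potential b < potential a
  potential-decreasing {a} {b} f with move-of-arc f
  ... | X′ , _ , inj₁ (X′⊂X , out) =
    +-mono-≤-< (p⊆q⇒∣p∣≤∣q∣ (R-antitone f)) (p⊂q⇒∣p∣<∣q∣ (X∪R-antitone f , cleared (proj₂ X′⊂X)))
    where
    cleared : ∃[ x ] (x ∈ X a × x ∉ X′) → ∃[ x ] (x ∈ X a ∪ R a × x ∉ X b ∪ R b)
    cleared (x , x∈X , x∉X′) =
      x , x∈p∪q⁺ (inj₁ x∈X) ,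
      [ x∉X′ ∘ subst (x ∈_) (cong proj₁ (unique-out-target out f))
      , (λ x∈R → R-disjoint-X a (R-antitone f x∈R) x∈X) ]′ ∘ x∈p∪q⁻ (X b) (R b)
  ... | X′ , X′⊆ , inj₂ (inj₁ ((_ , x , x∈X′ , x∉X) , out)) =
    +-mono-<-≤ (subst (λ r → ∣ r ∣ < ∣ R a ∣) (sym (cong proj₂ (unique-out-target out f)))
                      (p∩q≢∅⇒∣p─q∣<∣p∣ (R a) X′ (x , x∈p∩q⁺ (x∈R , x∈X′))))
               (p⊆q⇒∣p∣≤∣q∣ (X∪R-antitone f))
    where
    x∈R : x ∈ R a
    x∈R = unguarded⇒contaminated x∉X (x∈p∪q⁻ (X a) (R a) (X′⊆ x∈X′))
  ... | X′ , _ , inj₂ (inj₂ (_ , children , _ , C₁ , C₂ , fl₁ , C₁⊆ , fl₂ , C₂⊆ , C₁≢C₂)) =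
    +-mono-<-≤ (p⊂q⇒∣p∣<∣q∣ (R⊆ , Flaps.two-flaps⇒⊈-flap G (X a) flap fl₁ C₁⊆ fl₂ C₂⊆ C₁≢C₂))
               (p⊆q⇒∣p∣≤∣q∣ (X∪R-antitone f))
    where
    flap = proj₁ (proj₂ (children b f))
    R⊆ = proj₂ (proj₂ (children b f))

  -- Whether a node has an out-neighbour is undecidable, so the descent refutes ¬ Goal and
  -- the goal is recovered by decidability.
  module Descent (P : Fin m → Set) {Goal : Set} (Goal? : Dec Goal)
      (contaminated : ∀ a → P a → Goal ⊎ Nonempty (R a))
      (advance : ∀ a → P a → Move a → Goal ⊎ ∃[ b ] (F a b × P b)) where

    refute      : ∀ a → Acc (_<_ on potential) a → P a → ¬ ¬ Goal
    refute-move : ∀ a → Acc (_<_ on potential) a → P a → ¬ Goal → ¬ Move a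
    refute a ac pa ¬goal with contaminated a pa
    ... | inj₁ goal = ¬goal goal
    ... | inj₂ (v , v∈R) with a ≟ᶠ root
    ...   | yes a≡root = refute-move a ac pa ¬goal (proj₂ (nonleaf a (inj₁ a≡root)))
    ...   | no  a≢root =
      ∉⊥ (subst (v ∈_) (leaf a a≢root (λ _ → refute-move a ac pa ¬goal ∘ move-of-arc)) v∈R)
    refute-move a (acc smaller) pa ¬goal move with advance a pa move
    ... | inj₁ goal         = ¬goal goal
    ... | inj₂ (b , f , pb) = refute b (smaller (potential-decreasing f)) pb ¬goal

    descend : ∀ a → P a → Goal
    descend a pa = decidable-stable Goal? (refute a (on-wellFounded potential <-wellFounded a) pa)

  advance-contaminated : ∀ a {v} → v ∈ R a → Move a →
    ∃[ b ] (F a b × (v ∈ R b ⊎ (∀ {w} → Uncleared a w → Uncleared b w)))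
  advance-contaminated a v∈R (X′ , _ , inj₁ (_ , b , f , target , _)) =
    b , f , inj₁ (subst (_ ∈_) (sym (cong proj₂ target)) v∈R)
  advance-contaminated a v∈R (X′ , _ , inj₂ (inj₁ ((X⊆X′ , _) , b , f , target , _))) =
    b , f , inj₂ grow
    where
    grow : ∀ {w} → Uncleared a w → Uncleared b w
    grow (inj₁ w∈X) = inj₁ (subst (_ ∈_) (sym (cong proj₁ target)) (X⊆X′ w∈X))
    grow {w} (inj₂ w∈R) with w ∈? X′
    ... | yes w∈X′ = inj₁ (subst (_ ∈_) (sym (cong proj₁ target)) w∈X′)
    ... | no  w∉X′ = inj₂ (subst (_ ∈_) (sym (cong proj₂ target)) (x∈p∧x∉q⇒x∈p─q w∈R w∉X′))
  advance-contaminated a v∈R (X′ , _ , inj₂ (inj₂ (_ , _ , children , _))) =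
    let b , f , v∈R′ = in-flap-child a v∈R children in b , f , inj₁ v∈R′

  cover : ∀ v → ∃[ i ] (v ∈ X i)
  cover v = Descent.descend (λ a → Uncleared a v) (any? (λ i → v ∈? X i)) contaminated advance
              root (inj₂ (R-root v))
    where
    contaminated : ∀ a → Uncleared a v → ∃[ i ] (v ∈ X i) ⊎ Nonempty (R a)
    contaminated a (inj₁ v∈X) = inj₁ (a , v∈X)
    contaminated a (inj₂ v∈R) = inj₂ (v , v∈R)

    advance : ∀ a → Uncleared a v → Move a → ∃[ i ] (v ∈ X i) ⊎ ∃[ b ] (F a b × Uncleared b v)
    advance a (inj₁ v∈X) _ = inj₁ (a , v∈X)
    advance a (inj₂ v∈R) move with advance-contaminated a v∈R move
    ... | b , f , inj₁ v∈R′ = inj₂ (b , f , inj₂ v∈R′)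
    ... | b , f , inj₂ grow = inj₂ (b , f , grow (inj₂ v∈R))

  edges : ∀ u v → Edge G u v → ∃[ i ] (u ∈ X i × v ∈ X i)
  edges u v uv = Descent.descend Both (any? (λ i → (u ∈? X i) ×-dec (v ∈? X i))) contaminated advance
                   root (inj₂ (R-root u) , inj₂ (R-root v))
    where
    Both : Fin m → Set
    Both a = Uncleared a u × Uncleared a v

    vu : Edge G v u
    vu = trans (sym (Graph.adj-sym G u v)) uv

    along-edge : ∀ {a w w′} → Edge G w w′ → w ∈ R a → Uncleared a w′ → Move a →
      ∃[ b ] (F a b × Uncleared b w × Uncleared b w′)
    along-edge {a} e w∈R w′ move with advance-contaminated a w∈R move
    ... | b , f , inj₁ w∈R′ = b , f , inj₂ w∈R′ , R-closed b w∈R′ e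
    ... | b , f , inj₂ grow = b , f , grow (inj₂ w∈R) , grow w′

    contaminated : ∀ a → Both a → ∃[ i ] (u ∈ X i × v ∈ X i) ⊎ Nonempty (R a)
    contaminated a (inj₁ u∈X , inj₁ v∈X) = inj₁ (a , u∈X , v∈X)
    contaminated a (inj₂ u∈R , _)        = inj₂ (u , u∈R)
    contaminated a (_ , inj₂ v∈R)        = inj₂ (v , v∈R)

    advance : ∀ a → Both a → Move a → ∃[ i ] (u ∈ X i × v ∈ X i) ⊎ ∃[ b ] (F a b × Both b)
    advance a (inj₁ u∈X , inj₁ v∈X) _ = inj₁ (a , u∈X , v∈X)
    advance a (inj₂ u∈R , v′) move =
      let b , f , u″ , v″ = along-edge uv u∈R v′ move in inj₂ (b , f , u″ , v″)
    advance a (u′ , inj₂ v∈R) move =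
      let b , f , v″ , u″ = along-edge vu v∈R u′ move in inj₂ (b , f , u″ , v″)

  module _ (v : Fin n) where

    guarded-path : ∀ {a i} → v ∈ X a → Walk F (λ l → Uncleared l v) a i → Walk F (λ l → v ∈ X l) a i
    guarded-path = lift-forward-closed stays-guarded
      where
      stays-guarded : ∀ {a b} → F a b → v ∈ X a → Uncleared b v → v ∈ X b
      stays-guarded f v∈X (inj₁ v∈X′) = v∈X′
      stays-guarded f v∈X (inj₂ v∈R′) = contradiction (R-disjoint-X _ (R-antitone f v∈R′) v∈X)

    contaminated-child-unique : ∀ {a b₁ b₂} → F a b₁ → F a b₂ → v ∈ R a →
      Uncleared b₁ v → Uncleared b₂ v → b₁ ≡ b₂
    contaminated-child-unique {a} {b₁} {b₂} f₁ f₂ v∈R u₁ u₂ with move-of-arc f₁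
    ... | _ , _ , inj₁ (_ , _ , _ , _ , out)        = trans (out b₁ f₁) (sym (out b₂ f₂))
    ... | _ , _ , inj₂ (inj₁ (_ , _ , _ , _ , out)) = trans (out b₁ f₁) (sym (out b₂ f₂))
    ... | _ , _ , inj₂ (inj₂ (_ , children , _)) =
      pos-inj b₁ b₂ (cong₂ _,_ (trans X₁ (sym X₂))
        (Flaps.flap-unique G (X a) (proj₁ (proj₂ (children b₁ f₁))) (proj₁ (proj₂ (children b₂ f₂)))
                           (contaminated-in X₁ u₁) (contaminated-in X₂ u₂)))
      where
      X₁ = proj₁ (children b₁ f₁)
      X₂ = proj₁ (children b₂ f₂)
      contaminated-in : ∀ {b} → X b ≡ X a → Uncleared b v → v ∈ R b
      contaminated-in X≡ = unguarded⇒contaminated (R-disjoint-X a v∈R ∘ subst (v ∈_) X≡)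

    -- Two root paths through nodes with v ∈ X ∪ R agree until v is guarded, then stay guarded.
    join-paths : ∀ {a i j} → Walk F (λ l → Uncleared l v) a i → Walk F (λ l → Uncleared l v) a j →
      v ∈ X i → v ∈ X j → Walk (Undirected F) (λ l → v ∈ X l) i j
    join-paths {a} p q v∈Xi v∈Xj with v ∈? X a
    ... | yes v∈X = reverseᵘ (undirected (guarded-path v∈X p)) ++ʷ undirected (guarded-path v∈X q)
    join-paths (stop _)       _             v∈Xi _    | no v∉X = contradiction (v∉X v∈Xi)
    join-paths (step _ _ _)   (stop _)      _    v∈Xj | no v∉X = contradiction (v∉X v∈Xj)
    join-paths (step va f₁ p) (step _ f₂ q) v∈Xi v∈Xj | no v∉X
      with contaminated-child-unique f₁ f₂ (unguarded⇒contaminated v∉X va)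
                                     (walk-head p) (walk-head q)
    ... | refl = join-paths p q v∈Xi v∈Xj

    subtree : ∀ i j → v ∈ X i → v ∈ X j → Walk (Undirected F) (λ l → v ∈ X l) i j
    subtree i j v∈Xi v∈Xj =
      join-paths (root-path i (inj₁ v∈Xi)) (root-path j (inj₁ v∈Xj)) v∈Xi v∈Xj
      where
      root-path : ∀ i → Uncleared i v → Walk F (λ l → Uncleared l v) root i
      root-path i = lift-backward-closed Uncleared-antitone (reachable i)

  strategy-tree : IsTree (Undirected F)
  strategy-tree = record
    { symmetric   = λ _ _ → ⊎-swap
    ; irreflexive = Forest.irreflexive potential potential-decreasing in-unique
    ; connected   = λ a b → reverseᵘ (undirected (reachable a)) ++ʷ undirected (reachable b)
    ; acyclic     = Forest.acyclic potential potential-decreasing in-unique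
    }

lemma7 : ∀ {n} (G : Graph n) → Connected G → (k : ℕ) → 1 ≤ k → (S : MSS G k) →
    IsTreeDecomposition G (Undirected (MSS.F S)) (MSS.X S)
    × WidthAtMost (MSS.X S) (k ∸ 1)
lemma7 G _ k _ S =
  record { tree = strategy-tree ; cover = cover ; edges = edges ; subtree = subtree }
  , λ i → ∸-monoˡ-≤ 1 (MSS.searchers S i)
  where open Strategy S
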